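{- Let $C$ be a degree-safe component. If $(G, k, I_s, I_t)$ is a yes-instance, then there exists a reconfiguration sequence from $I_s$ to $I_t$ in $G$ where we have at most one token in $N(C) \subseteq L_2$ at all times.
   Context: $(G, k, I_s, I_t)$ is an instance of Token Sliding (given a graph $G$ and independent sets $I_s, I_t$ of size $k$, decide whether one can go from $I_s$ to $I_t$ through independent sets of size $k$ where each step slides one token along an edge of $G$), where $G$ has girth at least five and twin vertices not in $I_s \cup I_t$ have been removed. Let $L_1 = I_s \cup I_t$, $L_2 = N_G(L_1)$ and $L_3 = V(G) \setminus (L_1 \cup L_2)$. A maximal connected component $C$ of $G[L_3]$ is degree-safe if $G[V(C)]$ has a vertex $u$ with at least $k^2+1$ neighbors $X$ in $C$ of which at least $k^2$ have degree two in $G[V(C)]$. -}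

module Defs where

open import Data.Nat using (ℕ; _^_; _+_; _≤_)
open import Data.Fin using (Fin)
open import Data.Fin.Subset using (Subset; _∈_; _∉_; ∣_∣)
open import Data.List using (List; length)
open import Data.List.Relation.Unary.All using (All)
open import Data.List.Relation.Unary.Unique.Propositional using (Unique)
import Data.List.Membership.Propositional as LM
open import Data.Product using (Σ; _×_; ∃)
open import Data.Sum using (_⊎_)
open import Data.Unit using (⊤)
open import Relation.Nullary using (¬_; Dec)
open import Relation.Binary.PropositionalEquality using (_≡_; _≢_)
open import Function.Bundles using (_⇔_)

record Graph : Set₁ where
  field
    n     : ℕ
    Adj   : Fin n → Fin n → Set
    adj?  : ∀ u v → Dec (Adj u v)
    sym   : ∀ {u v} → Adj u v → Adj v u
    irrefl : ∀ {u} → ¬ Adj u u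
open Graph public

module _ (G : Graph) where
  private
    V = Fin (n G)
    E = Adj G

  GirthAtLeast5 : Set
  GirthAtLeast5 =
    (∀ a b c → ¬ (E a b × E b c × E c a)) ×
    (∀ a b c d → a ≢ c → b ≢ d → ¬ (E a b × E b c × E c d × E d a))

  Independent : Subset (n G) → Set
  Independent I = ∀ u v → u ∈ I → v ∈ I → ¬ E u v

  IndSetOfSize : ℕ → Subset (n G) → Set
  IndSetOfSize k I = Independent I × ∣ I ∣ ≡ k

  Slide : Subset (n G) → Subset (n G) → Set
  Slide I J = Σ V λ u → Σ V λ v →
    E u v × u ∈ I × v ∉ I × u ∉ J × v ∈ J ×
    (∀ w → w ≢ u → w ≢ v → (w ∈ I ⇔ w ∈ J))

  data ReconfSeq (k : ℕ) (P : Subset (n G) → Set) : Subset (n G) → Subset (n G) → Set where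
    done : ∀ {I} → IndSetOfSize k I → P I → ReconfSeq k P I I
    step : ∀ {I J K} → IndSetOfSize k I → P I → Slide I J →
           ReconfSeq k P J K → ReconfSeq k P I K

  Trivial : Subset (n G) → Set
  Trivial _ = ⊤

  data WalkIn (S : V → Set) : V → V → Set where
    here : ∀ {v} → S v → WalkIn S v v
    cons : ∀ {u w v} → S u → E u w → WalkIn S w v → WalkIn S u v

  module Layers (Is It : Subset (n G)) where
    L1 : V → Set
    L1 v = v ∈ Is ⊎ v ∈ It

    L2 : V → Set
    L2 v = ¬ L1 v × (Σ V λ w → L1 w × E v w)

    L3 : V → Set
    L3 v = ¬ L1 v × ¬ L2 v

    NoTwinsOutsideL1 : Set
    NoTwinsOutsideL1 = ∀ u v → u ≢ v → ¬ L1 u → ¬ L1 v →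
      ¬ (∀ w → E u w ⇔ E v w)

    -- the maximal connected component of G[L3] containing c (c ∈ L3)
    InComp : V → V → Set
    InComp c v = WalkIn L3 c v

    InNbhdComp : V → V → Set
    InNbhdComp c v = ¬ InComp c v × (Σ V λ w → InComp c w × E w v)

    DegTwoInComp : V → V → Set
    DegTwoInComp c y = Σ V λ a → Σ V λ b → a ≢ b ×
      InComp c a × InComp c b × E y a × E y b ×
      (∀ w → InComp c w → E y w → w ≡ a ⊎ w ≡ b)

    open LM using () renaming (_∈_ to _∈ₗ_)

    DegreeSafe : ℕ → V → Set
    DegreeSafe k c = Σ V λ u → InComp c u × Σ (List V) λ X → Σ (List V) λ Y →
      Unique X × All (λ x → InComp c x × E u x) X × k ^ 2 + 1 ≤ length X ×
      Unique Y × All (λ y → y ∈ₗ X × DegTwoInComp c y) Y × k ^ 2 ≤ length Y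

    AtMostOneInNC : V → Subset (n G) → Set
    AtMostOneInNC c I = ∀ u v → u ∈ I → v ∈ I → InNbhdComp c u → InNbhdComp c v → u ≡ v

-- Let u be the vertex of C given by degree-safeness.  Each of its degree-two neighbours x has
-- exactly one further neighbour y in C; call such a pair (x , y) a leg.  As G has no triangles,
-- the ends of k² legs span a triangle-free graph, so k legs with pairwise non-adjacent ends
-- can be selected.  The given sequence is then simulated: while m tokens of I lie in C ∪ N(C),
-- the simulating set keeps the other tokens of I and has m tokens parked on the middles
-- X 0 … X (m - 1) of the legs.  Slides away from C ∪ N(C) are copied; a token sliding into N(C)
-- is instead walked through C to the middle of the next free leg, and an exit is an entry
-- played backwards.  During such a walk parked tokens step aside from X i to Y i where needed,
-- and girth five keeps every intermediate set independent with only the walking token in N(C).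

module Submission where

open import Defs hiding (sym)
open import Data.Empty using (⊥)
open import Data.Fin using (Fin; zero; suc; toℕ; fromℕ<)
open import Data.Fin.Properties using (any?; toℕ<n; toℕ-injective; toℕ-fromℕ<) renaming (_≟_ to _≟ᶠ_)
open import Data.Fin.Subset using (Subset; _∈_; _∉_; _⊆_; ∣_∣; _-_; _∩_; _∪_; ⁅_⁆; inside; outside)
open import Data.Fin.Subset.Properties
  using (_∈?_; ⊆-antisym; p─⊥≡p; p─q⊆p; p∩q⊆p; p∩q⊆q; x∈p∧x≢y⇒x∈p-y; x∈p⇒∣p-x∣<∣p∣; p⊂q⇒∣p∣<∣q∣;
         x∈p∩q⁺; x∈p∪q⁺; x∈p∪q⁻; x∈⁅x⁆; x∈⁅y⁆⇒x≡y)
open import Data.List using (List; []; _∷_; length; filter; lookup; allFin)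
open import Data.List.Properties using (length-tabulate)
open import Data.List.Membership.Propositional using (find) renaming (_∈_ to _∈ₗ_)
open import Data.List.Membership.Propositional.Properties using (∈-filter⁻; ∈-lookup)
open import Data.List.Relation.Binary.Subset.Propositional using () renaming (_⊆_ to _⊆ₗ_)
open import Data.List.Relation.Unary.All using () renaming (tabulate to tabulateᴬ; lookup to lookupᴬ)
open import Data.List.Relation.Unary.AllPairs using (_∷_) renaming ([] to []ᴾ)
open import Data.List.Relation.Unary.Any using (Any; here; there) renaming (any? to anyₗ?)
open import Data.List.Relation.Unary.Unique.Propositional using (Unique)
open import Data.List.Relation.Unary.Unique.Propositional.Properties using (filter⁺; allFin⁺; Unique[x∷xs]⇒x∉xs)
open import Data.Maybe using (Maybe; just; nothing)
open import Data.Maybe.Properties using (just-injective) renaming (≡-dec to ≡-dec-Maybe)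
open import Data.Nat using (ℕ; zero; suc; _+_; _*_; _^_; _≤_; _<_; z≤n; s≤s; _≤?_)
open import Data.Nat.Properties
  using (_<?_; ≤-refl; ≤-reflexive; ≤-trans; <⇒≤; <-irrefl; n≮0; ≰⇒>; m<n⇒m<1+n; m<1+n⇒m<n∨m≡n;
         +-identityʳ; +-suc; *-suc; *-identityʳ; +-mono-≤; +-monoˡ-≤; +-cancelˡ-≤; m+n≤o⇒n≤o; m+1+n≰m;
         module ≤-Reasoning)
open import Data.Product using (Σ; ∃; _×_; _,_; proj₁; proj₂)
open import Data.Sum using (_⊎_; inj₁; inj₂; [_,_]′; swap)
import Data.Sum as Sum
open import Data.Vec using (_∷_; here; there; tabulate)
open import Data.Vec.Properties using (lookup∘tabulate; []=⇒lookup; lookup⇒[]=)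
open import Data.Vec.Functional using (Vector; updateAt)
open import Data.Vec.Functional.Properties using (updateAt-updates; updateAt-minimal)
open import Function using (_∘_; const; id)
open import Function.Bundles using (_⇔_; mk⇔; Equivalence)
open import Function.Properties.Equivalence using () renaming (sym to ⇔-sym)
open import Relation.Binary using (Rel; DecidableEquality)
open import Relation.Binary.Construct.Closure.ReflexiveTransitive using (Star; ε; _◅_; _◅◅_; reverse)
open import Relation.Binary.Construct.Closure.ReflexiveTransitive.Properties using (module StarReasoning; reflexive)
open import Relation.Binary.PropositionalEquality
  using (_≡_; _≢_; _≗_; refl; sym; trans; cong; subst; module ≡-Reasoning)
open import Relation.Nullary using (¬_; Dec; does; yes; no; contradiction)
open import Relation.Nullary.Decidable using (dec-true; map′; ¬?; _×-dec_; _⊎-dec_)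
open import Relation.Unary using (Decidable)
open import Relation.Unary.Properties using (∁?; U?)

private
  variable
    m : ℕ

subsetOf : {P : Fin m → Set} → Decidable P → Subset m
subsetOf P? = tabulate (λ v → does (P? v))

module _ {P : Fin m → Set} (P? : Decidable P) where

  ∈-subsetOf⁺ : ∀ {v} → P v → v ∈ subsetOf P?
  ∈-subsetOf⁺ {v} pv = lookup⇒[]= v _ (trans (lookup∘tabulate _ v) (dec-true (P? v) pv))

  ∈-subsetOf⁻ : ∀ {v} → v ∈ subsetOf P? → P v
  ∈-subsetOf⁻ {v} v∈ with P? v | trans (sym (lookup∘tabulate (λ w → does (P? w)) v)) ([]=⇒lookup v∈)
  ... | yes pv | _ = pv
  ... | no _   | ()

subsetOf-≡ : {P Q : Fin m → Set} (P? : Decidable P) (Q? : Decidable Q) →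
             (∀ {v} → P v → Q v) → (∀ {v} → Q v → P v) → subsetOf P? ≡ subsetOf Q?
subsetOf-≡ P? Q? P⇒Q Q⇒P =
  ⊆-antisym (∈-subsetOf⁺ Q? ∘ P⇒Q ∘ ∈-subsetOf⁻ P?) (∈-subsetOf⁺ P? ∘ Q⇒P ∘ ∈-subsetOf⁻ Q?)

∣p∣≡1+∣p-x∣ : {p : Subset m} {x : Fin m} → x ∈ p → ∣ p ∣ ≡ suc ∣ p - x ∣
∣p∣≡1+∣p-x∣ {p = inside ∷ p} here = cong suc (cong ∣_∣ (sym (p─⊥≡p p)))
∣p∣≡1+∣p-x∣ {p = inside ∷ p} (there x∈p) = cong suc (∣p∣≡1+∣p-x∣ x∈p)
∣p∣≡1+∣p-x∣ {p = outside ∷ p} (there x∈p) = ∣p∣≡1+∣p-x∣ x∈p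

x∉p-x : {p : Subset m} (x : Fin m) → x ∉ p - x
x∉p-x {p = s ∷ p} (suc x) (there x∈) = x∉p-x x x∈

module _ {p : Subset m} {y : Fin m} where

  ∈-∪⁅⁆⁺ : ∀ {x} → x ∈ p ⊎ x ≡ y → x ∈ p ∪ ⁅ y ⁆
  ∈-∪⁅⁆⁺ = x∈p∪q⁺ ∘ Sum.map₂ λ { refl → x∈⁅x⁆ y }

  ∈-∪⁅⁆⁻ : ∀ {x} → x ∈ p ∪ ⁅ y ⁆ → x ∈ p ⊎ x ≡ y
  ∈-∪⁅⁆⁻ = Sum.map₂ (x∈⁅y⁆⇒x≡y y) ∘ x∈p∪q⁻ p ⁅ y ⁆

lookup-injective : ∀ {A : Set} {xs : List A} → Unique xs → ∀ {i j} → lookup xs i ≡ lookup xs j → i ≡ j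
lookup-injective {xs = _ ∷ _} _ {zero} {zero} _ = refl
lookup-injective {xs = _ ∷ _} (x∉ ∷ _) {zero} {suc j} x≡ = contradiction x≡ (lookupᴬ x∉ (∈-lookup j))
lookup-injective {xs = _ ∷ _} (x∉ ∷ _) {suc i} {zero} ≡x = contradiction (sym ≡x) (lookupᴬ x∉ (∈-lookup i))
lookup-injective {xs = _ ∷ _} (_ ∷ u) {suc i} {suc j} eq = cong suc (lookup-injective u eq)

-- Independent sets in triangle-free graphs

module _ {A : Set} {R : A → A → Set} (R? : ∀ a b → Dec (R a b))
         (R-sym : ∀ {a b} → R a b → R b a) (R-irrefl : ∀ {a} → ¬ R a a)
         (R-triangle-free : ∀ {a b d} → R a b → R b d → R d a → ⊥) where

  IndependentList : List A → Set
  IndependentList S = ∀ {a b} → a ∈ₗ S → b ∈ₗ S → ¬ R a b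

  private
    degree : A → List A → ℕ
    degree a L = length (filter (R? a) L)

    non-neighbours : A → List A → List A
    non-neighbours a L = filter (∁? (R? a)) L

    length-split : ∀ a L → length L ≡ degree a L + length (non-neighbours a L)
    length-split a [] = refl
    length-split a (b ∷ L) with R? a b
    ... | yes _ = cong suc (length-split a L)
    ... | no _  = trans (cong suc (length-split a L)) (sym (+-suc _ _))

    neighbours-independent : ∀ a L → IndependentList (filter (R? a) L)
    neighbours-independent a L b∈ d∈ Rbd = R-triangle-free (proj₂ (N⁻ b∈)) Rbd (R-sym (proj₂ (N⁻ d∈)))
      where
      N⁻ : ∀ {b} → b ∈ₗ filter (R? a) L → b ∈ₗ L × R a b
      N⁻ = ∈-filter⁻ (R? a) {xs = L}

    degree-self : ∀ a T → degree a (a ∷ T) ≡ degree a T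
    degree-self a T with R? a a
    ... | yes Raa = contradiction Raa R-irrefl
    ... | no _ = refl

    low-degree : ∀ {k a T} → ¬ Any (λ b → suc k ≤ degree b (a ∷ T)) (a ∷ T) → degree a T ≤ k
    low-degree {k} {a} {T} none with suc k ≤? degree a (a ∷ T)
    ... | yes deg> = contradiction (here deg>) none
    ... | no deg≯ with s≤s le ← ≰⇒> deg≯ = subst (_≤ k) (degree-self a T) le

    many-non-neighbours : ∀ {k} a T → k + k * suc k ≤ length T → degree a T ≤ k →
                          k * k ≤ length (non-neighbours a T)
    many-non-neighbours {k} a T len low = m+n≤o⇒n≤o k (+-cancelˡ-≤ k _ _ (begin
      k + (k + k * k)                           ≡⟨ cong (k +_) (*-suc k k) ⟨
      k + k * suc k                             ≤⟨ len ⟩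
      length T                                  ≡⟨ length-split a T ⟩
      degree a T + length (non-neighbours a T)  ≤⟨ +-mono-≤ low ≤-refl ⟩
      k + length (non-neighbours a T)           ∎))
      where open ≤-Reasoning

    cons-non-neighbour : ∀ {a T S} → ¬ a ∈ₗ T → Unique S → S ⊆ₗ non-neighbours a T → IndependentList S →
                         Unique (a ∷ S) × a ∷ S ⊆ₗ a ∷ T × IndependentList (a ∷ S)
    cons-non-neighbour {a} {T} {S} a∉T uS S⊆ indS =
      tabulateᴬ (λ b∈ a≡b → a∉T (subst (_∈ₗ T) (sym a≡b) (inT b∈))) ∷ uS , ⊆aT , ind
      where
      inT : ∀ {b} → b ∈ₗ S → b ∈ₗ T
      inT = proj₁ ∘ ∈-filter⁻ (∁? (R? a)) {xs = T} ∘ S⊆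
      ¬Rab : ∀ {b} → b ∈ₗ S → ¬ R a b
      ¬Rab = proj₂ ∘ ∈-filter⁻ (∁? (R? a)) {xs = T} ∘ S⊆
      ⊆aT : a ∷ S ⊆ₗ a ∷ T
      ⊆aT (here refl) = here refl
      ⊆aT (there b∈) = there (inT b∈)
      ind : IndependentList (a ∷ S)
      ind (here refl) (here refl) = R-irrefl
      ind (here refl) (there d∈) = ¬Rab d∈
      ind (there b∈) (here refl) = ¬Rab b∈ ∘ R-sym
      ind (there b∈) (there d∈) = indS b∈ d∈

  -- For k + 1: the neighbours of an element of degree > k are pairwise non-adjacent; if there
  -- is no such element, keep the head, drop its at most k neighbours and recurse on the rest.
  independent-sublist : ∀ k L → Unique L → k * k ≤ length L →
                        ∃ λ S → Unique S × S ⊆ₗ L × IndependentList S × k ≤ length S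
  independent-sublist zero L _ _ = [] , []ᴾ , (λ ()) , (λ ()) , z≤n
  independent-sublist (suc k) L uL len with anyₗ? (λ a → suc k ≤? degree a L) L
  ... | yes high with a , _ , deg> ← find high =
    filter (R? a) L , filter⁺ (R? a) uL , proj₁ ∘ ∈-filter⁻ (R? a) {xs = L} , neighbours-independent a L , deg>
  independent-sublist (suc k) (a ∷ T) uL@(_ ∷ uT) (s≤s len) | no none
    with S , uS , S⊆ , indS , k≤S ← independent-sublist k (non-neighbours a T) (filter⁺ (∁? (R? a)) uT)
                                      (many-non-neighbours a T len (low-degree none))
    with uS′ , S⊆′ , indS′ ← cons-non-neighbour (Unique[x∷xs]⇒x∉xs uL) uS S⊆ indS
    = a ∷ S , uS′ , S⊆′ , indS′ , s≤s k≤S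

module _ (G : Graph) where
  private
    V = Fin (n G)
    E = Adj G
    variable
      S S′ : V → Set
      a b d : V
      I J K : Subset (n G)

  walk-head : WalkIn G S a b → S a
  walk-head (here s) = s
  walk-head (cons s _ _) = s

  walk-last : WalkIn G S a b → S b
  walk-last (here s) = s
  walk-last (cons _ _ w) = walk-last w

  walk-map : (∀ {v} → S v → S′ v) → WalkIn G S a b → WalkIn G S′ a b
  walk-map f (here s) = here (f s)
  walk-map f (cons s e w) = cons (f s) e (walk-map f w)

  walk-snoc : WalkIn G S a b → E b d → S d → WalkIn G S a d
  walk-snoc (here s) e s′ = cons s e (here s′)
  walk-snoc (cons s e w) e′ s′ = cons s e (walk-snoc w e′ s′)

  walk-reverse : WalkIn G S a b → WalkIn G S b a
  walk-reverse (here s) = here s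
  walk-reverse (cons s e w) = walk-snoc (walk-reverse w) (Graph.sym G e) s

  walk-++ : WalkIn G S a b → WalkIn G S b d → WalkIn G S a d
  walk-++ (here _) w′ = w′
  walk-++ (cons s e w) w′ = cons s e (walk-++ w w′)

  walk-after-last : {A : Subset (n G)} → WalkIn G (_∈ A) a b → b ≢ d →
                    WalkIn G (_∈ A - d) a b ⊎ ∃ λ q → E d q × WalkIn G (_∈ A - d) q b
  walk-after-last (here b∈) b≢d = inj₁ (here (x∈p∧x≢y⇒x∈p-y b∈ b≢d))
  walk-after-last {a = a} {d = d} (cons a∈ e w) b≢d with walk-after-last w b≢d | a ≟ᶠ d
  ... | inj₂ later  | _        = inj₂ later
  ... | inj₁ w′     | yes refl = inj₂ (_ , e , w′)
  ... | inj₁ w′     | no a≢d   = inj₁ (cons (x∈p∧x≢y⇒x∈p-y a∈ a≢d) e w′)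

  private
    walkWithin? : ∀ fuel (A : Subset (n G)) → ∣ A ∣ ≤ fuel → ∀ a b → Dec (WalkIn G (_∈ A) a b)
    walkWithin? zero A ∣A∣≤0 a b =
      no λ w → n≮0 (≤-trans (x∈p⇒∣p-x∣<∣p∣ (walk-head w)) ∣A∣≤0)
    walkWithin? (suc fuel) A ∣A∣≤ a b with a ∈? A | a ≟ᶠ b
    ... | no a∉ | _ = no (a∉ ∘ walk-head)
    ... | yes a∈ | yes refl = yes (here a∈)
    ... | yes a∈ | no a≢b
      with any? (λ q → adj? G a q ×-dec walkWithin? fuel (A - a) ∣A-a∣≤ q b)
      where
      ∣A-a∣≤ : ∣ A - a ∣ ≤ fuel
      ∣A-a∣≤ with s≤s le ← ≤-trans (x∈p⇒∣p-x∣<∣p∣ a∈) ∣A∣≤ = le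
    ... | yes (q , e , w) = yes (cons a∈ e (walk-map (p─q⊆p A _) w))
    ... | no none = no λ w → [ (λ w′ → x∉p-x a (walk-head w′)) , none ]′ (walk-after-last w (a≢b ∘ sym))

  walkIn? : Decidable S → ∀ a b → Dec (WalkIn G S a b)
  walkIn? S? a b with walkWithin? _ (subsetOf S?) ≤-refl a b
  ... | yes w = yes (walk-map (∈-subsetOf⁻ S?) w)
  ... | no ¬w = no (¬w ∘ walk-map (∈-subsetOf⁺ S?))

  slide-sym : Slide G I J → Slide G J I
  slide-sym (u , v , e , u∈I , v∉I , u∉J , v∈J , same) =
    v , u , Graph.sym G e , v∈J , u∉J , v∉I , u∈I , λ w w≢v w≢u → ⇔-sym (same w w≢u w≢v)

  slide-subsetOf : {A B : V → Set} (A? : Decidable A) (B? : Decidable B) → E a b →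
                   A a → ¬ A b → ¬ B a → B b →
                   (∀ {w} → w ≢ a → w ≢ b → A w → B w) →
                   (∀ {w} → w ≢ a → w ≢ b → B w → A w) →
                   Slide G (subsetOf A?) (subsetOf B?)
  slide-subsetOf A? B? e Aa ¬Ab ¬Ba Bb A⇒B B⇒A =
    _ , _ , e , ∈-subsetOf⁺ A? Aa , ¬Ab ∘ ∈-subsetOf⁻ A? , ¬Ba ∘ ∈-subsetOf⁻ B? , ∈-subsetOf⁺ B? Bb ,
    λ w w≢a w≢b → mk⇔ (∈-subsetOf⁺ B? ∘ A⇒B w≢a w≢b ∘ ∈-subsetOf⁻ A?)
                      (∈-subsetOf⁺ A? ∘ B⇒A w≢a w≢b ∘ ∈-subsetOf⁻ B?)

  private
    slide-remainder : (sl : Slide G I J) → I - proj₁ sl ⊆ J - proj₁ (proj₂ sl)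
    slide-remainder {I} (u , v , e , u∈I , v∉I , u∉J , v∈J , same) {w} w∈ =
      x∈p∧x≢y⇒x∈p-y (Equivalence.to (same w w≢u w≢v) w∈I) w≢v
      where
      w∈I = p─q⊆p I _ w∈
      w≢u = λ w≡u → x∉p-x u (subst (_∈ I - u) w≡u w∈)
      w≢v = λ w≡v → v∉I (subst (_∈ I) w≡v w∈I)

  slide-size : Slide G I J → ∣ I ∣ ≡ ∣ J ∣
  slide-size {I} {J} sl@(u , v , _ , u∈I , _ , _ , v∈J , _) = begin
    ∣ I ∣          ≡⟨ ∣p∣≡1+∣p-x∣ u∈I ⟩
    suc ∣ I - u ∣  ≡⟨ cong (suc ∘ ∣_∣) (⊆-antisym (slide-remainder sl) (slide-remainder (slide-sym sl))) ⟩
    suc ∣ J - v ∣  ≡⟨ ∣p∣≡1+∣p-x∣ v∈J ⟨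
    ∣ J ∣          ∎
    where open ≡-Reasoning

  slide-keeps : (sl : Slide G I J) → a ∈ I → a ≢ proj₁ sl → a ∈ J
  slide-keeps (_ , _ , _ , _ , v∉I , _ , _ , same) a∈I a≢u =
    Equivalence.to (same _ a≢u λ { refl → v∉I a∈I }) a∈I

  head-independent : ∀ {k P} → ReconfSeq G k P I J → Independent G I
  head-independent (done (ind , _) _) = ind
  head-independent (step (ind , _) _ _ _) = ind

  SafeSlide : (Subset (n G) → Set) → Rel (Subset (n G)) _
  SafeSlide P I J = P I × Slide G I J × P J

  Moves : (Subset (n G) → Set) → Rel (Subset (n G)) _
  Moves P = Star (SafeSlide P)

  moves-reverse : ∀ {P} → Moves P I J → Moves P J I
  moves-reverse = reverse λ (pI , sl , pJ) → pJ , slide-sym sl , pI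

  moves-size : ∀ {P} → Moves P I J → ∣ I ∣ ≡ ∣ J ∣
  moves-size ε = refl
  moves-size ((_ , sl , _) ◅ ms) = trans (slide-size sl) (moves-size ms)

  prepend-moves : ∀ {k Q} → Moves (λ I → Independent G I × Q I) I J → ∣ I ∣ ≡ k →
                  ReconfSeq G k Q J K → ReconfSeq G k Q I K
  prepend-moves ε _ seq = seq
  prepend-moves (((indI , qI) , sl , _) ◅ ms) ∣I∣≡k seq =
    step (indI , ∣I∣≡k) qI sl (prepend-moves ms (trans (sym (slide-size sl)) ∣I∣≡k) seq)

data LegState : Set where
  vacant onX onY : LegState

_≟ˢ_ : DecidableEquality LegState
vacant ≟ˢ vacant = yes refl
onX    ≟ˢ onX    = yes refl
onY    ≟ˢ onY    = yes refl
vacant ≟ˢ onX    = no λ ()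
vacant ≟ˢ onY    = no λ ()
onX    ≟ˢ vacant = no λ ()
onX    ≟ˢ onY    = no λ ()
onY    ≟ˢ vacant = no λ ()
onY    ≟ˢ onX    = no λ ()

module Component (G : Graph) (girth : GirthAtLeast5 G) (Is It : Subset (n G)) (c : Fin (n G)) where
  open Layers G Is It public
  private
    V = Fin (n G)
    E = Adj G
    E-sym : ∀ {a b} → E a b → E b a
    E-sym = Graph.sym G
    variable
      a b d f p q s v w x : V
      F F′ : Subset (n G)

  no-triangle : E a b → E b d → E d a → ⊥
  no-triangle e₁ e₂ e₃ = proj₁ girth _ _ _ (e₁ , e₂ , e₃)

  no-square : a ≢ d → b ≢ f → E a b → E b d → E d f → E f a → ⊥
  no-square a≢d b≢f e₁ e₂ e₃ e₄ = proj₂ girth _ _ _ _ a≢d b≢f (e₁ , e₂ , e₃ , e₄)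

  Inside Boundary Outside : V → Set
  Inside = InComp c
  Boundary = InNbhdComp c
  Outside v = ¬ Inside v × ¬ Boundary v

  Apart : V → V → Set
  Apart p v = p ≢ v × ¬ E p v

  Good : Subset (n G) → Set
  Good I = Independent G I × AtMostOneInNC c I

  inside⇒L3 : Inside v → L3 v
  inside⇒L3 = walk-last G

  inside-step : Inside p → E p q → L3 q → Inside q
  inside-step = walk-snoc G

  L1⇒outside : L1 v → Outside v
  L1⇒outside l1 = (λ v∈C → proj₁ (inside⇒L3 v∈C) l1) ,
                  (λ (_ , w , w∈C , e) → proj₂ (inside⇒L3 w∈C) (proj₁ (inside⇒L3 w∈C) , _ , l1 , e))

  outside-inside-apart : Outside a → Inside x → Apart a x
  outside-inside-apart (a∉C , a∉N) x∈C =
    (λ { refl → a∉C x∈C }) , λ e → a∉N (a∉C , _ , x∈C , E-sym e)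

  apart-sym : Apart a b → Apart b a
  apart-sym (a≢b , a≁b) = a≢b ∘ sym , a≁b ∘ E-sym

  boundary-not-inside : Boundary w → ¬ Inside w
  boundary-not-inside = proj₁

  L3? : Decidable L3
  L3? v = ¬? (L1? v) ×-dec ¬? (¬? (L1? v) ×-dec any? (λ w → L1? w ×-dec adj? G v w))
    where
    L1? : Decidable L1
    L1? v = (v ∈? Is) ⊎-dec (v ∈? It)

  inside? : Decidable Inside
  inside? = walkIn? G L3? c

  boundary? : Decidable Boundary
  boundary? v = ¬? (inside? v) ×-dec any? (λ w → inside? w ×-dec adj? G w v)

  outside? : Decidable Outside
  outside? v = ¬? (inside? v) ×-dec ¬? (boundary? v)

  outside-neighbour : Outside a → E a b → ¬ Outside b → Boundary b
  outside-neighbour {b = b} a-out e b-not-out with boundary? b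
  ... | yes b∈N = b∈N
  ... | no b∉N = contradiction ((λ b∈C → proj₂ (outside-inside-apart a-out b∈C) e) , b∉N) b-not-out

  -- Legs at a vertex of C

  record IsLeg (u x y : V) : Set where
    field
      u~x : E u x
      x~y : E x y
      x-inside : Inside x
      y-inside : Inside y
      y≢u : y ≢ u
      x-degree-two : ∀ {w} → Inside w → E x w → w ≡ u ⊎ w ≡ y

  record Legs (u : V) : Set where
    field
      g : ℕ
      X Y : Fin g → V
      is-leg : ∀ i → IsLeg u (X i) (Y i)
      X-injective : ∀ {i j} → X i ≡ X j → i ≡ j
      Y-independent : ∀ i j → ¬ E (Y i) (Y j)

  Settled : Subset (n G) → Set
  Settled F = (∀ {v} → v ∈ F → Outside v) × Independent G F

  settled-⊆ : F′ ⊆ F → Settled F → Settled F′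
  settled-⊆ F′⊆F (F-outside , F-independent) =
    F-outside ∘ F′⊆F , λ a b a∈ b∈ → F-independent a b (F′⊆F a∈) (F′⊆F b∈)

  settled-insert : Settled F → Outside a → (∀ {v} → v ∈ F → Apart a v) → Settled (F ∪ ⁅ a ⁆)
  settled-insert {F = F} {a = a} (F-outside , F-independent) a-outside a-apart =
    (λ v∈ → [ F-outside , (λ { refl → a-outside }) ]′ (∈-∪⁅⁆⁻ v∈)) ,
    λ v w v∈ w∈ → edge (∈-∪⁅⁆⁻ v∈) (∈-∪⁅⁆⁻ w∈)
    where
    edge : v ∈ F ⊎ v ≡ a → w ∈ F ⊎ w ≡ a → ¬ E v w
    edge (inj₁ v∈F) (inj₁ w∈F) = F-independent _ _ v∈F w∈F
    edge (inj₁ v∈F) (inj₂ refl) = proj₂ (a-apart v∈F) ∘ E-sym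
    edge (inj₂ refl) (inj₁ w∈F) = proj₂ (a-apart w∈F)
    edge (inj₂ refl) (inj₂ refl) = Graph.irrefl G

  module Maneuvers {u : V} (u-inside : Inside u) (legs : Legs u) where
    open Legs legs
    private
      module L i = IsLeg (is-leg i)
      variable
        i j t i₀ : Fin g
        I J : Subset (n G)
        σ σ′ : Vector LegState g
        T T′ : Maybe V

    X≢X : i ≢ j → X i ≢ X j
    X≢X i≢j = i≢j ∘ X-injective

    X-independent : ∀ i j → ¬ E (X i) (X j)
    X-independent i j e = no-triangle (L.u~x i) e (E-sym (L.u~x j))

    X≁Y : i ≢ j → ¬ E (X i) (Y j)
    X≁Y {i} {j} i≢j e = no-square (X≢X i≢j) (L.y≢u j) e (E-sym (L.x~y j)) (E-sym (L.u~x j)) (L.u~x i)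

    u≁Y : ∀ i → ¬ E u (Y i)
    u≁Y i e = no-triangle (L.u~x i) (L.x~y i) (E-sym e)

    Y≢X : ∀ i j → Y i ≢ X j
    Y≢X i j Yi≡Xj = u≁Y i (subst (E u) (sym Yi≡Xj) (L.u~x j))

    Y-injective : Y i ≡ Y j → i ≡ j
    Y-injective {i} {j} Yi≡Yj with i ≟ᶠ j
    ... | yes i≡j = i≡j
    ... | no i≢j = contradiction (subst (E (X i)) Yi≡Yj (L.x~y i)) (X≁Y i≢j)

    u-neighbour≁X : E u s → ¬ E s (X i)
    u-neighbour≁X {i = i} u~s e = no-triangle u~s e (E-sym (L.u~x i))

    u-neighbour≁Y : E u s → s ≢ X i → ¬ E s (Y i)
    u-neighbour≁Y {i = i} u~s s≢X e = no-square s≢X (L.y≢u i) e (E-sym (L.x~y i)) (E-sym (L.u~x i)) u~s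

    -- A configuration consists of fixed tokens F outside C ∪ N(C), a state for every leg, and
    -- possibly one moving token.
    data Token (F : Subset (n G)) (σ : Vector LegState g) (v : V) : Set where
      fixed : v ∈ F → Token F σ v
      atX   : σ i ≡ onX → X i ≡ v → Token F σ v
      atY   : σ i ≡ onY → Y i ≡ v → Token F σ v

    data Occupied (F : Subset (n G)) (σ : Vector LegState g) (T : Maybe V) (v : V) : Set where
      token : Token F σ v → Occupied F σ T v
      mover   : T ≡ just v → Occupied F σ T v

    token? : ∀ F σ → Decidable (Token F σ)
    token? F σ v = map′ decode encode
      ((v ∈? F) ⊎-dec any? (λ i → (σ i ≟ˢ onX) ×-dec (X i ≟ᶠ v))
                ⊎-dec any? (λ i → (σ i ≟ˢ onY) ×-dec (Y i ≟ᶠ v)))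
      where
      decode : v ∈ F ⊎ (∃ λ i → σ i ≡ onX × X i ≡ v) ⊎ (∃ λ i → σ i ≡ onY × Y i ≡ v) →
               Token F σ v
      decode (inj₁ v∈F) = fixed v∈F
      decode (inj₂ (inj₁ (_ , s , eq))) = atX s eq
      decode (inj₂ (inj₂ (_ , s , eq))) = atY s eq
      encode : Token F σ v →
               v ∈ F ⊎ (∃ λ i → σ i ≡ onX × X i ≡ v) ⊎ (∃ λ i → σ i ≡ onY × Y i ≡ v)
      encode (fixed v∈F) = inj₁ v∈F
      encode (atX s eq) = inj₂ (inj₁ (_ , s , eq))
      encode (atY s eq) = inj₂ (inj₂ (_ , s , eq))

    occupied? : ∀ F σ T → Decidable (Occupied F σ T)
    occupied? F σ T v = map′ [ token , mover ]′ encode (token? F σ v ⊎-dec ≡-dec-Maybe _≟ᶠ_ T (just v))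
      where
      encode : Occupied F σ T v → Token F σ v ⊎ T ≡ just v
      encode (token tok) = inj₁ tok
      encode (mover eq) = inj₂ eq

    conf : Subset (n G) → Vector LegState g → Maybe V → Subset (n G)
    conf F σ T = subsetOf (occupied? F σ T)

    conf-≡ : (∀ {v} → Occupied F σ T v → Occupied F′ σ′ T′ v) →
             (∀ {v} → Occupied F′ σ′ T′ v → Occupied F σ T v) →
             conf F σ T ≡ conf F′ σ′ T′
    conf-≡ {F} {σ} {T} {F′} {σ′} {T′} = subsetOf-≡ (occupied? F σ T) (occupied? F′ σ′ T′)

    Clear : Subset (n G) → Vector LegState g → V → Set
    Clear F σ p = ∀ {v} → Token F σ v → Apart p v

    tokens-independent : Settled F → Token F σ a → Token F σ b → ¬ E a b
    tokens-independent (_ , ind) (fixed a∈) (fixed b∈) = ind _ _ a∈ b∈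
    tokens-independent (out , _) (fixed a∈) (atX _ refl) = proj₂ (outside-inside-apart (out a∈) (L.x-inside _))
    tokens-independent (out , _) (fixed a∈) (atY _ refl) = proj₂ (outside-inside-apart (out a∈) (L.y-inside _))
    tokens-independent (out , _) (atX _ refl) (fixed b∈) =
      proj₂ (outside-inside-apart (out b∈) (L.x-inside _)) ∘ E-sym
    tokens-independent (out , _) (atY _ refl) (fixed b∈) =
      proj₂ (outside-inside-apart (out b∈) (L.y-inside _)) ∘ E-sym
    tokens-independent _ (atX _ refl) (atX _ refl) = X-independent _ _
    tokens-independent _ (atY _ refl) (atY _ refl) = Y-independent _ _
    tokens-independent _ (atX {i} s refl) (atY {j} s′ refl) with i ≟ᶠ j
    ... | yes refl = contradiction (trans (sym s) s′) λ ()
    ... | no i≢j = X≁Y i≢j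
    tokens-independent _ (atY {i} s refl) (atX {j} s′ refl) with j ≟ᶠ i
    ... | yes refl = contradiction (trans (sym s) s′) λ ()
    ... | no j≢i = X≁Y j≢i ∘ E-sym

    good : Settled F → Clear F σ p → Good (conf F σ (just p))
    good {F} {σ} {p} settled clear =
      (λ a b a∈ b∈ → independent (∈conf a∈) (∈conf b∈)) ,
      (λ a b a∈ b∈ a∈N b∈N →
        just-injective (trans (sym (only-mover (∈conf a∈) a∈N)) (only-mover (∈conf b∈) b∈N)))
      where
      ∈conf : v ∈ conf F σ (just p) → Occupied F σ (just p) v
      ∈conf = ∈-subsetOf⁻ (occupied? F σ (just p))
      independent : Occupied F σ (just p) a → Occupied F σ (just p) b → ¬ E a b
      independent (token ta) (token tb) = tokens-independent settled ta tb
      independent (token ta) (mover refl) = proj₂ (clear ta) ∘ E-sym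
      independent (mover refl) (token tb) = proj₂ (clear tb)
      independent (mover refl) (mover refl) = Graph.irrefl G
      only-mover : Occupied F σ (just p) v → Boundary v → just p ≡ just v
      only-mover (token (fixed v∈)) v∈N = contradiction v∈N (proj₂ (proj₁ settled v∈))
      only-mover (token (atX _ refl)) v∈N = contradiction (L.x-inside _) (boundary-not-inside v∈N)
      only-mover (token (atY _ refl)) v∈N = contradiction (L.y-inside _) (boundary-not-inside v∈N)
      only-mover (mover eq) _ = eq

    move : Settled F → Clear F σ p → Clear F σ q → E p q →
           SafeSlide G Good (conf F σ (just p)) (conf F σ (just q))
    move {F} {σ} {p} {q} settled clear-p clear-q e =
      good settled clear-p ,
      slide-subsetOf G (occupied? F σ (just p)) (occupied? F σ (just q)) e
        (mover refl) (vacated clear-q (p≢q ∘ sym)) (vacated clear-p p≢q) (mover refl)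
        keep (λ w≢p w≢q → keep w≢q w≢p) ,
      good settled clear-q
      where
      p≢q : p ≢ q
      p≢q refl = Graph.irrefl G e
      vacated : ∀ {a b} → Clear F σ a → a ≢ b → ¬ Occupied F σ (just b) a
      vacated clear-a _ (token tok) = proj₁ (clear-a tok) refl
      vacated _ a≢b (mover refl) = a≢b refl
      keep : ∀ {a b} → w ≢ a → w ≢ b → Occupied F σ (just a) w → Occupied F σ (just b) w
      keep _ _ (token tok) = token tok
      keep w≢a _ (mover refl) = contradiction refl w≢a

    retreat-leg : Settled F → Clear F σ p → Clear F σ′ p →
                  σ i ≡ onX → σ′ i ≡ onY → (∀ {j} → j ≢ i → σ j ≡ σ′ j) →
                  SafeSlide G Good (conf F σ (just p)) (conf F σ′ (just p))
    retreat-leg {F} {σ} {p} {σ′} {i} settled clear clear′ onX-before onY-after others =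
      good settled clear ,
      slide-subsetOf G (occupied? F σ (just p)) (occupied? F σ′ (just p)) (L.x~y i)
        (token (atX onX-before refl)) Y-free X-free (token (atY onY-after refl)) (keep others) (keep (sym ∘ others)) ,
      good settled clear′
      where
      Y-free : ¬ Occupied F σ (just p) (Y i)
      Y-free (token (fixed Y∈F)) = proj₁ (outside-inside-apart (proj₁ settled Y∈F) (L.y-inside i)) refl
      Y-free (token (atX _ X≡Y)) = Y≢X _ _ (sym X≡Y)
      Y-free (token (atY s Y≡Y)) with refl ← Y-injective Y≡Y = contradiction (trans (sym s) onX-before) λ ()
      Y-free (mover refl) = proj₁ (clear′ (atY onY-after refl)) refl
      X-free : ¬ Occupied F σ′ (just p) (X i)
      X-free (token (fixed X∈F)) = proj₁ (outside-inside-apart (proj₁ settled X∈F) (L.x-inside i)) refl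
      X-free (token (atX s X≡X)) with refl ← X-injective X≡X = contradiction (trans (sym s) onY-after) λ ()
      X-free (token (atY _ Y≡X)) = Y≢X _ _ Y≡X
      X-free (mover refl) = proj₁ (clear (atX onX-before refl)) refl
      keep : ∀ {τ τ′} → (∀ {j} → j ≢ i → τ j ≡ τ′ j) →
             w ≢ X i → w ≢ Y i → Occupied F τ (just p) w → Occupied F τ′ (just p) w
      keep _ _ _ (token (fixed w∈F)) = token (fixed w∈F)
      keep agree w≢X _ (token (atX {j} s refl)) = token (atX (trans (sym (agree (w≢X ∘ cong X))) s) refl)
      keep agree _ w≢Y (token (atY {j} s refl)) = token (atY (trans (sym (agree (w≢Y ∘ cong Y))) s) refl)
      keep _ _ _ (mover eq) = mover eq

    token-cong : σ ≗ σ′ → Token F σ v → Token F σ′ v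
    token-cong _ (fixed v∈F) = fixed v∈F
    token-cong σ≗σ′ (atX {i} s eq) = atX (trans (sym (σ≗σ′ i)) s) eq
    token-cong σ≗σ′ (atY {i} s eq) = atY (trans (sym (σ≗σ′ i)) s) eq

    conf-cong : ∀ F T → σ ≗ σ′ → conf F σ T ≡ conf F σ′ T
    conf-cong F T σ≗σ′ = conf-≡ (retag σ≗σ′) (retag (sym ∘ σ≗σ′))
      where
      retag : ∀ {τ τ′ v} → τ ≗ τ′ → Occupied F τ T v → Occupied F τ′ T v
      retag τ≗τ′ (token tok) = token (token-cong τ≗τ′ tok)
      retag _ (mover eq) = mover eq

    _[_]≔_ : Vector LegState g → Fin g → LegState → Vector LegState g
    σ [ i ]≔ s = updateAt σ i (const s)

    assign-≗ : ∀ {s} → σ′ i ≡ s → (∀ {j} → j ≢ i → σ j ≡ σ′ j) → σ [ i ]≔ s ≗ σ′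
    assign-≗ {σ′} {i} {σ} σ′i agree j with j ≟ᶠ i
    ... | yes refl = trans (updateAt-updates i σ) (sym σ′i)
    ... | no j≢i = trans (updateAt-minimal j i σ j≢i) (agree j≢i)

    conf-park : σ t ≡ vacant → conf F σ (just (X t)) ≡ conf F (σ [ t ]≔ onX) nothing
    conf-park {σ} {t} {F} vacant-t = conf-≡ park unpark
      where
      other : ∀ {i s} → σ i ≡ s → s ≢ vacant → (σ [ t ]≔ onX) i ≡ s
      other {i} σi≡s s≢vacant =
        trans (updateAt-minimal i t σ λ { refl → s≢vacant (trans (sym σi≡s) vacant-t) }) σi≡s
      park : Occupied F σ (just (X t)) v → Occupied F (σ [ t ]≔ onX) nothing v
      park (token (fixed v∈F)) = token (fixed v∈F)
      park (token (atX s eq)) = token (atX (other s λ ()) eq)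
      park (token (atY s eq)) = token (atY (other s λ ()) eq)
      park (mover refl) = token (atX (updateAt-updates t σ) refl)
      unpark : Occupied F (σ [ t ]≔ onX) nothing v → Occupied F σ (just (X t)) v
      unpark (token (fixed v∈F)) = token (fixed v∈F)
      unpark (token (atX {i} s eq)) with i ≟ᶠ t
      ... | yes refl = mover (cong just eq)
      ... | no i≢t = token (atX (trans (sym (updateAt-minimal i t σ i≢t)) s) eq)
      unpark (token (atY {i} s eq)) with i ≟ᶠ t
      ... | yes refl = contradiction (trans (sym (updateAt-updates t σ)) s) λ ()
      ... | no i≢t = token (atY (trans (sym (updateAt-minimal i t σ i≢t)) s) eq)

    conf-freeze : (∀ {v} → v ∈ F ⊎ v ≡ a → v ∈ F′) →
                  (∀ {v} → v ∈ F′ → v ∈ F ⊎ v ≡ a) →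
                  conf F σ (just a) ≡ conf F′ σ nothing
    conf-freeze {F} {a} {F′} {σ} into out = conf-≡ freeze thaw
      where
      freeze : Occupied F σ (just a) v → Occupied F′ σ nothing v
      freeze (token (fixed v∈F)) = token (fixed (into (inj₁ v∈F)))
      freeze (token (atX s eq)) = token (atX s eq)
      freeze (token (atY s eq)) = token (atY s eq)
      freeze (mover refl) = token (fixed (into (inj₂ refl)))
      thaw : Occupied F′ σ nothing v → Occupied F σ (just a) v
      thaw (token (fixed v∈F′)) = [ token ∘ fixed , (λ { refl → mover refl }) ]′ (out v∈F′)
      thaw (token (atX s eq)) = token (atX s eq)
      thaw (token (atY s eq)) = token (atY s eq)

    walk-moves : Settled F → WalkIn G (Clear F σ) p q → Moves G Good (conf F σ (just p)) (conf F σ (just q))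
    walk-moves settled (here _) = ε
    walk-moves settled (cons clear e w) = move settled clear (walk-head G w) e ◅ walk-moves settled w

    Retreats : Vector LegState g → Vector LegState g → Set
    Retreats σ σ′ = ∀ i → σ′ i ≡ σ i ⊎ (σ i ≡ onX × σ′ i ≡ onY)

    retreatLeg : LegState → LegState
    retreatLeg vacant = vacant
    retreatLeg onX = onY
    retreatLeg onY = onY

    retreat : {D : Fin g → Set} → Decidable D → Vector LegState g → Vector LegState g
    retreat D? σ i with D? i
    ... | yes _ = retreatLeg (σ i)
    ... | no _ = σ i

    module _ {D : Fin g → Set} (D? : Decidable D) where

      retreat-onX : ∀ σ i → retreat D? σ i ≡ onX → σ i ≡ onX × ¬ D i
      retreat-onX σ i eq with D? i
      ... | no ¬d = eq , ¬d
      ... | yes _ with σ i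
      ...   | vacant = contradiction eq λ ()
      ...   | onX = contradiction eq λ ()
      ...   | onY = contradiction eq λ ()

      retreat-onY : ∀ σ i → retreat D? σ i ≡ onY → σ i ≡ onY ⊎ (σ i ≡ onX × D i)
      retreat-onY σ i eq with D? i
      ... | no _ = inj₁ eq
      ... | yes d with σ i
      ...   | vacant = contradiction eq λ ()
      ...   | onX = inj₂ (refl , d)
      ...   | onY = inj₁ refl

      retreat-retreats : ∀ σ → Retreats σ (retreat D? σ)
      retreat-retreats σ i with D? i
      ... | no _ = inj₁ refl
      ... | yes _ with σ i
      ...   | vacant = inj₁ refl
      ...   | onX = inj₂ (refl , refl)
      ...   | onY = inj₁ refl

    splice : ℕ → Vector LegState g → Vector LegState g → Vector LegState g
    splice m σ σ′ i with toℕ i <? m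
    ... | yes _ = σ′ i
    ... | no _ = σ i

    module _ (σ σ′ : Vector LegState g) where

      splice-old : ∀ {m} i → ¬ toℕ i < m → splice m σ σ′ i ≡ σ i
      splice-old {m} i ¬lt with toℕ i <? m
      ... | yes lt = contradiction lt ¬lt
      ... | no _ = refl

      splice-new : ∀ {m} i → toℕ i < m → splice m σ σ′ i ≡ σ′ i
      splice-new {m} i lt with toℕ i <? m
      ... | yes _ = refl
      ... | no ¬lt = contradiction lt ¬lt

      module _ {m} (m<g : m < g) where

        splice-before : splice m σ σ′ (fromℕ< m<g) ≡ σ (fromℕ< m<g)
        splice-before = splice-old _ (<-irrefl (toℕ-fromℕ< m<g))

        splice-after : splice (suc m) σ σ′ (fromℕ< m<g) ≡ σ′ (fromℕ< m<g)
        splice-after = splice-new _ (s≤s (≤-reflexive (toℕ-fromℕ< m<g)))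

        splice-elsewhere : ∀ {j} → j ≢ fromℕ< m<g → splice m σ σ′ j ≡ splice (suc m) σ σ′ j
        splice-elsewhere {j} j≢new = by (toℕ j <? m)
          where
          by : Dec (toℕ j < m) → splice m σ σ′ j ≡ splice (suc m) σ σ′ j
          by (yes lt) = trans (splice-new j lt) (sym (splice-new j (m<n⇒m<1+n lt)))
          by (no ¬lt) = trans (splice-old j ¬lt) (sym (splice-old j ¬lt′))
            where
            ¬lt′ : ¬ toℕ j < suc m
            ¬lt′ lt′ with m<1+n⇒m<n∨m≡n lt′
            ... | inj₁ lt = ¬lt lt
            ... | inj₂ eq = j≢new (toℕ-injective (trans eq (sym (toℕ-fromℕ< m<g))))

    -- Legs are retreated one at a time: splice m σ σ′ has retreated exactly the legs below m.
    retreat-moves : Settled F → Retreats σ σ′ → Clear F σ p → Clear F σ′ p →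
                    Moves G Good (conf F σ (just p)) (conf F σ′ (just p))
    retreat-moves {F} {σ} {σ′} {p} settled retreats clear clear′ = begin
      conf F σ (just p)        ≡⟨ conf-cong F (just p) (λ i → sym (splice-old σ σ′ {0} i λ ())) ⟩
      conf F (mix 0) (just p)  ⟶*⟨ mix-moves g ≤-refl ⟩
      conf F (mix g) (just p)  ≡⟨ conf-cong F (just p) (λ i → splice-new σ σ′ i (toℕ<n i)) ⟩
      conf F σ′ (just p)       ∎
      where
      open StarReasoning (SafeSlide G Good)

      mix : ℕ → Vector LegState g
      mix m = splice m σ σ′

      clear-mix : ∀ m → Clear F (mix m) p
      clear-mix m (fixed v∈F) = clear (fixed v∈F)
      clear-mix m (atX {i} s eq) with toℕ i <? m
      ... | yes _ = clear′ (atX s eq)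
      ... | no _ = clear (atX s eq)
      clear-mix m (atY {i} s eq) with toℕ i <? m
      ... | yes _ = clear′ (atY s eq)
      ... | no _ = clear (atY s eq)

      mix-step : ∀ m (m<g : m < g) → Moves G Good (conf F (mix m) (just p)) (conf F (mix (suc m)) (just p))
      mix-step m m<g = advance (retreats leg)
        where
        leg = fromℕ< m<g
        advance : σ′ leg ≡ σ leg ⊎ (σ leg ≡ onX × σ′ leg ≡ onY) →
                  Moves G Good (conf F (mix m) (just p)) (conf F (mix (suc m)) (just p))
        advance (inj₁ same) = reflexive (SafeSlide G Good) (conf-cong F (just p) agree)
          where
          agree : ∀ j → mix m j ≡ mix (suc m) j
          agree j with j ≟ᶠ leg
          ... | no j≢leg = splice-elsewhere σ σ′ m<g j≢leg
          ... | yes refl = trans (splice-before σ σ′ m<g) (trans (sym same) (sym (splice-after σ σ′ m<g)))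
        advance (inj₂ (before , after)) =
          retreat-leg settled (clear-mix m) (clear-mix (suc m)) (trans (splice-before σ σ′ m<g) before)
                      (trans (splice-after σ σ′ m<g) after) (splice-elsewhere σ σ′ m<g) ◅ ε

      mix-moves : ∀ m → m ≤ g → Moves G Good (conf F (mix 0) (just p)) (conf F (mix m) (just p))
      mix-moves zero _ = ε
      mix-moves (suc m) m<g = mix-moves m (<⇒≤ m<g) ◅◅ mix-step m m<g

    Resting : Vector LegState g → Set
    Resting σ = ∀ i → σ i ≢ onY

    resting-assign : ∀ {s} → Resting σ → s ≢ onY → Resting (σ [ i ]≔ s)
    resting-assign {σ} {i} rest s≢onY j with j ≟ᶠ i
    ... | yes refl = s≢onY ∘ trans (sym (updateAt-updates i σ))
    ... | no j≢i = rest j ∘ trans (sym (updateAt-minimal j i σ j≢i))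

    states-differ : ∀ {s s′} → σ i ≡ s → σ j ≡ s′ → s ≢ s′ → i ≢ j
    states-differ σi≡s σj≡s′ s≢s′ refl = s≢s′ (trans (sym σi≡s) σj≡s′)

    clear-intro : (∀ {v} → v ∈ F → Apart p v) → (∀ {i} → σ i ≡ onX → Apart p (X i)) →
                  (∀ {i} → σ i ≡ onY → Apart p (Y i)) → Clear F σ p
    clear-intro fixed-apart _ _ (fixed v∈F) = fixed-apart v∈F
    clear-intro _ X-apart _ (atX s refl) = X-apart s
    clear-intro _ _ Y-apart (atY s refl) = Y-apart s

    clear-outside : Outside a → (∀ {v} → v ∈ F → Apart a v) → Clear F σ a
    clear-outside a-out fixed-apart =
      clear-intro fixed-apart (λ _ → outside-inside-apart a-out (L.x-inside _))
                              (λ _ → outside-inside-apart a-out (L.y-inside _))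

    module _ {D : Fin g → Set} (D? : Decidable D) where

      clear-retreat : Clear F σ p → (∀ {i} → D i → σ i ≡ onX → Apart p (Y i)) →
                      Clear F (retreat D? σ) p
      clear-retreat clear Y-apart (fixed v∈F) = clear (fixed v∈F)
      clear-retreat {σ = σ} clear Y-apart (atX {i} s refl) = clear (atX (proj₁ (retreat-onX D? σ i s)) refl)
      clear-retreat {σ = σ} clear Y-apart (atY {i} s refl) with retreat-onY D? σ i s
      ... | inj₁ onY-before = clear (atY onY-before refl)
      ... | inj₂ (onX-before , d) = Y-apart d onX-before

    retreatAll : Vector LegState g → Vector LegState g
    retreatAll = retreat U?

    retreatAll-onX : Resting σ → ∀ i → retreatAll σ i ≢ onX
    retreatAll-onX {σ} _ i s = proj₂ (retreat-onX U? σ i s) _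

    retreatAll-onY : Resting σ → ∀ i → retreatAll σ i ≡ onY → σ i ≡ onX
    retreatAll-onY {σ} rest i s with retreat-onY U? σ i s
    ... | inj₁ onY-before = contradiction onY-before (rest i)
    ... | inj₂ (onX-before , _) = onX-before

    -- Walking a token into C

    body-apart : ∀ i → Apart u (Y i)
    body-apart i = L.y≢u i ∘ sym , u≁Y i

    record Towards (x p : V) : Set where
      field
        in-component : Inside p
        not-body : p ≢ u
        body-neighbour : E u p → p ≡ x
        leg-end : ∀ {i} → p ≡ Y i → x ≡ X i

    -- Follow a walk from p to u and stop at the first vertex adjacent to u,
    -- jumping from an end Y i of a leg to its middle X i.
    route : WalkIn G L3 p u → Inside p → p ≢ u → ∃ λ x → E u x × WalkIn G (Towards x) p x
    route {p} walk p-inside p≢u with adj? G u p | any? (λ i → p ≟ᶠ Y i)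
    ... | yes u~p | _ = p , u~p , here record
      { in-component = p-inside ; not-body = p≢u ; body-neighbour = λ _ → refl
      ; leg-end = λ { refl → contradiction u~p (u≁Y _) } }
    ... | no u≁p | yes (i , refl) = X i , L.u~x i , cons towards-p (E-sym (L.x~y i)) (here towards-X)
      where
      towards-p : Towards (X i) (Y i)
      towards-p = record
        { in-component = p-inside ; not-body = p≢u ; body-neighbour = λ u~p → contradiction u~p u≁p
        ; leg-end = cong X ∘ Y-injective }
      towards-X : Towards (X i) (X i)
      towards-X = record
        { in-component = L.x-inside i ; not-body = λ { X≡u → Graph.irrefl G (subst (E u) X≡u (L.u~x i)) }
        ; body-neighbour = λ _ → refl ; leg-end = λ X≡Y → contradiction (sym X≡Y) (Y≢X _ i) }
    ... | no u≁p | no not-Y with walk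
    ...   | here _ = contradiction refl p≢u
    ...   | cons _ p~q rest =
      extend (route rest (inside-step p-inside p~q (walk-head G rest)) λ { refl → u≁p (E-sym p~q) })
      where
      extend : (∃ λ x → E u x × WalkIn G (Towards x) _ x) → ∃ λ x → E u x × WalkIn G (Towards x) p x
      extend (x , u~x , towards) = x , u~x , cons towards-p p~q towards
        where
        towards-p : Towards x p
        towards-p = record
          { in-component = p-inside ; not-body = p≢u ; body-neighbour = λ u~p → contradiction u~p u≁p
          ; leg-end = λ p≡Y → contradiction (_ , p≡Y) not-Y }

    record Entrance (F : Subset (n G)) (a w : V) : Set where
      field
        a-outside : Outside a
        a-apart : ∀ {v} → v ∈ F → Apart a v
        w-boundary : Boundary w
        a~w : E a w
        w≁F : ∀ {v} → v ∈ F → ¬ E w v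

    module Moving (settled : Settled F) where

      inside-fixed-apart : Inside p → v ∈ F → Apart p v
      inside-fixed-apart p-inside v∈F = apart-sym (outside-inside-apart (proj₁ settled v∈F) p-inside)

      clear-retreatAll : Resting σ → (∀ {i} → σ i ≡ onX → Apart p (Y i)) → Inside p →
                         Clear F (retreatAll σ) p
      clear-retreatAll rest Y-apart p-inside =
        clear-intro (inside-fixed-apart p-inside) (λ {i} s → contradiction s (retreatAll-onX rest i))
                                                  (λ {i} s → Y-apart (retreatAll-onY rest i s))

      body-clear : Resting σ → Clear F (retreatAll σ) u
      body-clear rest = clear-retreatAll rest (λ {i} _ → body-apart i) u-inside

      towards-clear : Resting σ → (∀ {i} → σ i ≡ onX → x ≢ X i) → Towards x p → Clear F σ p
      towards-clear {σ} {x} {p} rest x-unparked towards =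
        clear-intro (inside-fixed-apart in-component) (λ s → p≢X s , p≁X s) (λ {i} s → contradiction s (rest i))
        where
        open Towards towards
        p≢X : σ i ≡ onX → p ≢ X i
        p≢X {i} s refl = x-unparked s (sym (body-neighbour (L.u~x i)))
        p≁X : σ i ≡ onX → ¬ E p (X i)
        p≁X {i} s p~X with L.x-degree-two i in-component (E-sym p~X)
        ... | inj₁ p≡u = not-body p≡u
        ... | inj₂ p≡Y = x-unparked s (leg-end p≡Y)

      from-body : Resting σ → σ t ≡ vacant →
                  Moves G Good (conf F (retreatAll σ) (just u)) (conf F σ (just (X t)))
      from-body {σ} {t} rest vacant-t = begin
        conf F (retreatAll σ) (just u)      ⟶⟨ move settled (body-clear rest) Xt-clear↓ (L.u~x t) ⟩
        conf F (retreatAll σ) (just (X t))  ⟶*⟨ moves-reverse G (retreat-moves settled (retreat-retreats U? σ)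
                                                                              Xt-clear Xt-clear↓) ⟩
        conf F σ (just (X t))               ∎
        where
        open StarReasoning (SafeSlide G Good)
        t≢parked : σ i ≡ onX → t ≢ i
        t≢parked s t≡i = states-differ s vacant-t (λ ()) (sym t≡i)
        Xt-clear : Clear F σ (X t)
        Xt-clear = clear-intro (inside-fixed-apart (L.x-inside t)) (λ s → X≢X (t≢parked s) , X-independent t _)
                               (λ {i} s → contradiction s (rest i))
        Xt-clear↓ : Clear F (retreatAll σ) (X t)
        Xt-clear↓ = clear-retreatAll rest (λ s → Y≢X _ t ∘ sym , X≁Y (t≢parked s)) (L.x-inside t)

      cross : Resting σ → σ t ≡ vacant → Inside s → E u s → (∀ {i} → σ i ≡ onX → s ≢ X i) →
              Moves G Good (conf F σ (just s)) (conf F σ (just (X t)))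
      cross {σ} {t} {s} rest vacant-t s-inside u~s s-unparked = begin
        conf F σ (just s)               ⟶*⟨ retreat-moves settled (retreat-retreats U? σ) s-clear s-clear↓ ⟩
        conf F (retreatAll σ) (just s)  ⟶⟨ move settled s-clear↓ (body-clear rest) (E-sym u~s) ⟩
        conf F (retreatAll σ) (just u)  ⟶*⟨ from-body rest vacant-t ⟩
        conf F σ (just (X t))           ∎
        where
        open StarReasoning (SafeSlide G Good)
        s-clear : Clear F σ s
        s-clear = clear-intro (inside-fixed-apart s-inside) (λ p → s-unparked p , u-neighbour≁X u~s)
                              (λ {i} p → contradiction p (rest i))
        s-clear↓ : Clear F (retreatAll σ) s
        s-clear↓ = clear-retreatAll rest
          (λ p → (λ s≡Y → u≁Y _ (subst (E u) s≡Y u~s)) , u-neighbour≁Y u~s (s-unparked p)) s-inside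

      module _ (entrance : Entrance F a w) where
        open Entrance entrance

        w-fixed-apart : v ∈ F → Apart w v
        w-fixed-apart v∈F = (λ { refl → proj₂ (proj₁ settled v∈F) w-boundary }) , w≁F v∈F

        w≢leg : Inside v → w ≢ v
        w≢leg v-inside refl = boundary-not-inside w-boundary v-inside

        a-clear : Clear F σ a
        a-clear = clear-outside a-outside a-apart

        enter-via-body : E w u → Resting σ → σ t ≡ vacant →
                         Moves G Good (conf F σ (just a)) (conf F σ (just (X t)))
        enter-via-body {σ} {t} w~u rest vacant-t = begin
          conf F σ (just a)               ⟶*⟨ retreat-moves settled (retreat-retreats U? σ) a-clear a-clear ⟩
          conf F (retreatAll σ) (just a)  ⟶⟨ move settled a-clear w-clear↓ a~w ⟩
          conf F (retreatAll σ) (just w)  ⟶⟨ move settled w-clear↓ (body-clear rest) w~u ⟩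
          conf F (retreatAll σ) (just u)  ⟶*⟨ from-body rest vacant-t ⟩
          conf F σ (just (X t))           ∎
          where
          open StarReasoning (SafeSlide G Good)
          w-clear↓ : Clear F (retreatAll σ) w
          w-clear↓ = clear-intro w-fixed-apart (λ {i} s → contradiction s (retreatAll-onX rest i))
            λ {i} _ → w≢leg (L.y-inside i) ,
                      λ w~Y → no-square (w≢leg (L.x-inside i)) (L.y≢u i ∘ sym)
                                        w~u (L.u~x i) (L.x~y i) (E-sym w~Y)

        enter-along-route : E w p → WalkIn G (Towards x) p x →
                            Resting σ → (∀ {i} → σ i ≡ onX → x ≢ X i) →
                            Moves G Good (conf F σ (just a)) (conf F σ (just x))
        enter-along-route {p} {x} {σ} w~p towards rest x-unparked = begin
          conf F σ (just a)   ⟶*⟨ retreat-moves settled (retreat-retreats W? σ) a-clear a-clear ⟩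
          conf F σw (just a)  ⟶⟨ move settled a-clear w-clear a~w ⟩
          conf F σw (just w)  ⟶⟨ move settled w-clear p-clearʷ w~p ⟩
          conf F σw (just p)  ⟶*⟨ moves-reverse G (retreat-moves settled (retreat-retreats W? σ)
                                                                 p-clear p-clearʷ) ⟩
          conf F σ (just p)   ⟶*⟨ walk-moves settled (walk-map G (towards-clear rest x-unparked) towards) ⟩
          conf F σ (just x)   ∎
          where
          open StarReasoning (SafeSlide G Good)
          W? : Decidable (λ i → E w (X i))
          W? i = adj? G w (X i)
          σw = retreat W? σ
          w-clear : Clear F σw w
          w-clear = clear-intro w-fixed-apart
            (λ {i} s → w≢leg (L.x-inside i) , proj₂ (retreat-onX W? σ i s))
            (λ {i} s → w≢leg (L.y-inside i) , λ w~Y → [ (λ before → rest i before) ,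
                         (λ (_ , w~X) → no-triangle w~X (L.x~y i) (E-sym w~Y)) ]′ (retreat-onY W? σ i s))
          p-clear : Clear F σ p
          p-clear = towards-clear rest x-unparked (walk-head G towards)
          p-clearʷ : Clear F σw p
          p-clearʷ = clear-retreat W? p-clear λ {i} w~X parked →
            (λ p≡Y → no-triangle w~X (L.x~y i) (subst (λ q → E q w) p≡Y (E-sym w~p))) ,
            λ p~Y → no-square (proj₁ (p-clear (atX parked refl))) (w≢leg (L.y-inside i))
                              (E-sym w~p) w~X (L.x~y i) (E-sym p~Y)

    -- When the route of the entering token ends at an occupied X i₀, the token parked there
    -- first crosses to X t while the entering token waits among the fixed ones.
    enter-via-parked : Settled F → Entrance F a w → E w p → WalkIn G (Towards (X i₀)) p (X i₀) →
                       Resting σ → σ i₀ ≡ onX → σ t ≡ vacant →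
                       Moves G Good (conf F σ (just a)) (conf F (σ [ t ]≔ onX) nothing)
    enter-via-parked {F} {a} {i₀ = i₀} {σ} {t} settled entrance w~p towards rest parked vacant-t = begin
      conf F σ (just a)                  ≡⟨ conf-freeze ∈-∪⁅⁆⁺ ∈-∪⁅⁆⁻ ⟩
      conf F⁺ σ nothing                  ≡⟨ conf-cong F⁺ nothing unpark-park ⟩
      conf F⁺ (σ₁ [ i₀ ]≔ onX) nothing   ≡⟨ conf-park σ₁-i₀ ⟨
      conf F⁺ σ₁ (just (X i₀))           ⟶*⟨ Moving.cross settled⁺ rest₁ σ₁-t (L.x-inside i₀) (L.u~x i₀) unparked₁ ⟩
      conf F⁺ σ₁ (just (X t))            ≡⟨ conf-park σ₁-t ⟩
      conf F⁺ σ₂ nothing                 ≡⟨ conf-freeze ∈-∪⁅⁆⁺ ∈-∪⁅⁆⁻ ⟨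
      conf F σ₂ (just a)                 ⟶*⟨ Moving.enter-along-route settled entrance w~p towards rest₂ unparked₂ ⟩
      conf F σ₂ (just (X i₀))            ≡⟨ conf-park σ₂-i₀ ⟩
      conf F (σ₂ [ i₀ ]≔ onX) nothing    ≡⟨ conf-cong F nothing swap-parked ⟩
      conf F (σ [ t ]≔ onX) nothing      ∎
      where
      open StarReasoning (SafeSlide G Good)
      F⁺ = F ∪ ⁅ a ⁆
      settled⁺ : Settled F⁺
      settled⁺ = settled-insert settled (Entrance.a-outside entrance) (Entrance.a-apart entrance)
      σ₁ = σ [ i₀ ]≔ vacant
      σ₂ = σ₁ [ t ]≔ onX
      i₀≢t : i₀ ≢ t
      i₀≢t = states-differ parked vacant-t λ ()
      σ₁-i₀ : σ₁ i₀ ≡ vacant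
      σ₁-i₀ = updateAt-updates i₀ σ
      σ₁-t : σ₁ t ≡ vacant
      σ₁-t = trans (updateAt-minimal t i₀ σ (i₀≢t ∘ sym)) vacant-t
      σ₂-i₀ : σ₂ i₀ ≡ vacant
      σ₂-i₀ = trans (updateAt-minimal i₀ t σ₁ i₀≢t) σ₁-i₀
      unpark-park : σ ≗ σ₁ [ i₀ ]≔ onX
      unpark-park = sym ∘ assign-≗ parked (updateAt-minimal _ i₀ σ)
      swap-parked : σ₂ [ i₀ ]≔ onX ≗ σ [ t ]≔ onX
      swap-parked = assign-≗ (trans (updateAt-minimal i₀ t σ i₀≢t) parked) λ {j} j≢i₀ → away j j≢i₀
        where
        away : ∀ j → j ≢ i₀ → σ₂ j ≡ (σ [ t ]≔ onX) j
        away j j≢i₀ with j ≟ᶠ t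
        ... | yes refl = trans (updateAt-updates t σ₁) (sym (updateAt-updates t σ))
        ... | no j≢t = trans (updateAt-minimal j t σ₁ j≢t)
                         (trans (updateAt-minimal j i₀ σ j≢i₀) (sym (updateAt-minimal j t σ j≢t)))
      rest₁ : Resting σ₁
      rest₁ = resting-assign rest λ ()
      rest₂ : Resting σ₂
      rest₂ = resting-assign rest₁ λ ()
      unparked₁ : ∀ {i} → σ₁ i ≡ onX → X i₀ ≢ X i
      unparked₁ s = states-differ σ₁-i₀ s (λ ()) ∘ X-injective
      unparked₂ : ∀ {i} → σ₂ i ≡ onX → X i₀ ≢ X i
      unparked₂ s = states-differ σ₂-i₀ s (λ ()) ∘ X-injective

    -- The entering token walks into C along a route to a neighbour x of u and then crosses
    -- over u to X t.
    enter : Settled F → Entrance F a w → Resting σ → σ t ≡ vacant →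
            Moves G Good (conf F σ (just a)) (conf F (σ [ t ]≔ onX) nothing)
    enter {F} {a} {w} {σ} {t} settled entrance rest vacant-t with Entrance.w-boundary entrance
    ... | _ , z , z-inside , z~w with z ≟ᶠ u
    ...   | yes refl = Moving.enter-via-body settled entrance (E-sym z~w) rest vacant-t
                       ◅◅ reflexive (SafeSlide G Good) (conf-park vacant-t)
    ...   | no z≢u with route (walk-++ G (walk-reverse G z-inside) u-inside) z-inside z≢u
    ...     | x , u~x , towards with any? (λ i → (σ i ≟ˢ onX) ×-dec (x ≟ᶠ X i))
    ...       | yes (i₀ , parked , refl) = enter-via-parked settled entrance (E-sym z~w) towards rest parked vacant-t
    ...       | no unparked = begin
      conf F σ (just a)              ⟶*⟨ Moving.enter-along-route settled entrance (E-sym z~w) towards rest x-unparked ⟩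
      conf F σ (just x)              ⟶*⟨ Moving.cross settled rest vacant-t x-inside u~x x-unparked ⟩
      conf F σ (just (X t))          ≡⟨ conf-park vacant-t ⟩
      conf F (σ [ t ]≔ onX) nothing  ∎
      where
      open StarReasoning (SafeSlide G Good)
      x-unparked : ∀ {i} → σ i ≡ onX → x ≢ X i
      x-unparked s x≡X = unparked (_ , s , x≡X)
      x-inside : Inside x
      x-inside = Towards.in-component (walk-last G towards)

    -- Simulating a reconfiguration sequence

    ∈-conf⁺ : ∀ F σ T → Occupied F σ T v → v ∈ conf F σ T
    ∈-conf⁺ F σ T = ∈-subsetOf⁺ (occupied? F σ T)

    ∈-conf⁻ : ∀ F σ T → v ∈ conf F σ T → Occupied F σ T v
    ∈-conf⁻ F σ T = ∈-subsetOf⁻ (occupied? F σ T)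

    parkedBelow : ℕ → Vector LegState g
    parkedBelow m = splice m (const vacant) (const onX)

    parkedBelow-resting : ∀ m → Resting (parkedBelow m)
    parkedBelow-resting m i with toℕ i <? m
    ... | yes _ = λ ()
    ... | no _ = λ ()

    parkedBelow-onX : ∀ m i → parkedBelow m i ≡ onX → toℕ i < m
    parkedBelow-onX m i eq with toℕ i <? m
    ... | yes lt = lt
    ... | no _ = contradiction eq λ ()

    parkedBelow-suc : ∀ {m} (m<g : m < g) → parkedBelow m [ fromℕ< m<g ]≔ onX ≗ parkedBelow (suc m)
    parkedBelow-suc m<g = assign-≗ (splice-after _ _ m<g) (splice-elsewhere _ _ m<g)

    conf-parked-zero : conf F (parkedBelow 0) nothing ≡ F
    conf-parked-zero {F} =
      ⊆-antisym (fixed-only ∘ ∈-conf⁻ F (parkedBelow 0) nothing)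
                (∈-conf⁺ F (parkedBelow 0) nothing ∘ token ∘ fixed)
      where
      fixed-only : Occupied F (parkedBelow 0) nothing v → v ∈ F
      fixed-only (token (fixed v∈F)) = v∈F
      fixed-only (token (atX {i} s _)) = contradiction (parkedBelow-onX 0 i s) λ ()
      fixed-only (token (atY {i} s _)) = contradiction s (parkedBelow-resting 0 i)

    parked-size : Settled F → ∀ m → m ≤ g → ∣ F ∣ + m ≤ ∣ conf F (parkedBelow m) nothing ∣
    parked-size {F} _ zero _ = begin
      ∣ F ∣ + 0                                ≡⟨ +-identityʳ _ ⟩
      ∣ F ∣                                    ≡⟨ cong ∣_∣ conf-parked-zero ⟨
      ∣ conf F (parkedBelow 0) nothing ∣       ∎
      where open ≤-Reasoning
    parked-size {F} settled (suc m) m<g = begin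
      ∣ F ∣ + suc m                             ≡⟨ +-suc _ m ⟩
      suc (∣ F ∣ + m)                           ≤⟨ s≤s (parked-size settled m (<⇒≤ m<g)) ⟩
      suc ∣ conf F (parkedBelow m) nothing ∣    ≤⟨ p⊂q⇒∣p∣<∣q∣ (grow , X new , new∈ , new∉) ⟩
      ∣ conf F (parkedBelow (suc m)) nothing ∣  ∎
      where
      open ≤-Reasoning
      new = fromℕ< m<g
      still : Occupied F (parkedBelow m) nothing v → Occupied F (parkedBelow (suc m)) nothing v
      still (token (fixed v∈F)) = token (fixed v∈F)
      still (token (atX {i} s eq)) = token (atX (splice-new _ _ i (m<n⇒m<1+n (parkedBelow-onX m i s))) eq)
      still (token (atY {i} s _)) = contradiction s (parkedBelow-resting m i)
      grow : conf F (parkedBelow m) nothing ⊆ conf F (parkedBelow (suc m)) nothing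
      grow = ∈-conf⁺ F (parkedBelow (suc m)) nothing ∘ still ∘ ∈-conf⁻ F (parkedBelow m) nothing
      new∈ : X new ∈ conf F (parkedBelow (suc m)) nothing
      new∈ = ∈-conf⁺ F (parkedBelow (suc m)) nothing (token (atX (splice-after _ _ m<g) refl))
      new∉ : X new ∉ conf F (parkedBelow m) nothing
      new∉ X∈ with ∈-conf⁻ F (parkedBelow m) nothing X∈
      ... | token (fixed X∈F) = proj₁ (proj₁ settled X∈F) (L.x-inside new)
      ... | token (atX s eq) with refl ← X-injective eq = contradiction (trans (sym (splice-before _ _ m<g)) s) λ ()
      ... | token (atY {i} s _) = contradiction s (parkedBelow-resting m i)

    outPart : Subset (n G) → Subset (n G)
    outPart I = I ∩ subsetOf outside?

    ∈-outPart⁺ : v ∈ I → Outside v → v ∈ outPart I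
    ∈-outPart⁺ v∈I v-out = x∈p∩q⁺ (v∈I , ∈-subsetOf⁺ outside? v-out)

    outPart⊆ : outPart I ⊆ I
    outPart⊆ {I} = p∩q⊆p I _

    outPart-outside : v ∈ outPart I → Outside v
    outPart-outside {I = I} = ∈-subsetOf⁻ outside? ∘ p∩q⊆q I _

    settled-outPart : Independent G I → Settled (outPart I)
    settled-outPart independent =
      outPart-outside ,
      λ a b a∈ b∈ → independent a b (outPart⊆ a∈) (outPart⊆ b∈)

    outPart-of-outside : (∀ {v} → v ∈ I → Outside v) → outPart I ≡ I
    outPart-of-outside I-out = ⊆-antisym outPart⊆ λ v∈I → ∈-outPart⁺ v∈I (I-out v∈I)

    slide-outPart : (sl : Slide G I J) → v ∈ outPart I → v ≢ proj₁ sl → v ∈ outPart J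
    slide-outPart sl v∈ v≢p = ∈-outPart⁺ (slide-keeps G sl (outPart⊆ v∈) v≢p) (outPart-outside v∈)

    simulation : Subset (n G) → ℕ → Subset (n G)
    simulation I m = conf (outPart I) (parkedBelow m) nothing

    module _ (indI : Independent G I) (indJ : Independent G J) where

      entering : (sl : Slide G I J) → Outside (proj₁ sl) → ¬ Outside (proj₁ (proj₂ sl)) →
                 ∀ {m} (m<g : m < g) → Moves G Good (simulation I m) (simulation J (suc m))
      entering sl@(p , q , p~q , p∈I , _ , p∉J , q∈J , _) p-out q-not-out {m} m<g = begin
        simulation I m                                                ≡⟨ conf-freeze into out ⟨
        conf (outPart J) (parkedBelow m) (just p)                     ⟶*⟨ enter (settled-outPart indJ) entrance
                                                                            (parkedBelow-resting m) (splice-before _ _ m<g) ⟩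
        conf (outPart J) (parkedBelow m [ fromℕ< m<g ]≔ onX) nothing  ≡⟨ conf-cong _ nothing (parkedBelow-suc m<g) ⟩
        simulation J (suc m)                                          ∎
        where
        open StarReasoning (SafeSlide G Good)
        into : v ∈ outPart J ⊎ v ≡ p → v ∈ outPart I
        into (inj₁ v∈) = slide-outPart (slide-sym G sl) v∈ λ { refl → q-not-out (outPart-outside v∈) }
        into (inj₂ refl) = ∈-outPart⁺ p∈I p-out
        out : v ∈ outPart I → v ∈ outPart J ⊎ v ≡ p
        out {v} v∈ with v ≟ᶠ p
        ... | yes v≡p = inj₂ v≡p
        ... | no v≢p = inj₁ (slide-outPart sl v∈ v≢p)
        entrance : Entrance (outPart J) p q
        entrance = record
          { a-outside = p-out
          ; a-apart = λ v∈ → (λ { refl → p∉J (outPart⊆ v∈) }) , indI _ _ p∈I (outPart⊆ (into (inj₁ v∈)))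
          ; w-boundary = outside-neighbour p-out p~q q-not-out
          ; a~w = p~q
          ; w≁F = λ v∈ → indJ _ _ q∈J (outPart⊆ v∈) }

      sliding-outside : (sl : Slide G I J) → Outside (proj₁ sl) → Outside (proj₁ (proj₂ sl)) →
                        ∀ m → Moves G Good (simulation I m) (simulation J m)
      sliding-outside sl@(p , q , p~q , p∈I , q∉I , p∉J , q∈J , _) p-out q-out m = begin
        simulation I m                ≡⟨ conf-freeze [ K⊆I , (λ { refl → ∈-outPart⁺ p∈I p-out }) ]′ outI ⟨
        conf K (parkedBelow m) (just p)  ⟶⟨ move (settled-⊆ K⊆I (settled-outPart indI)) p-clear q-clear p~q ⟩
        conf K (parkedBelow m) (just q)  ≡⟨ conf-freeze [ K⊆J , (λ { refl → ∈-outPart⁺ q∈J q-out }) ]′ outJ ⟩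
        simulation J m                ∎
        where
        open StarReasoning (SafeSlide G Good)
        K = outPart I ∩ outPart J
        K⊆I : K ⊆ outPart I
        K⊆I = p∩q⊆p _ _
        K⊆J : K ⊆ outPart J
        K⊆J = p∩q⊆q _ _
        outI : v ∈ outPart I → v ∈ K ⊎ v ≡ p
        outI {v} v∈ with v ≟ᶠ p
        ... | yes v≡p = inj₂ v≡p
        ... | no v≢p = inj₁ (x∈p∩q⁺ (v∈ , slide-outPart sl v∈ v≢p))
        outJ : v ∈ outPart J → v ∈ K ⊎ v ≡ q
        outJ {v} v∈ with v ≟ᶠ q
        ... | yes v≡q = inj₂ v≡q
        ... | no v≢q = inj₁ (x∈p∩q⁺ (slide-outPart (slide-sym G sl) v∈ v≢q , v∈))
        p-clear : Clear K (parkedBelow m) p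
        p-clear = clear-outside p-out λ v∈ →
          (λ { refl → p∉J (outPart⊆ (K⊆J v∈)) }) , indI _ _ p∈I (outPart⊆ (K⊆I v∈))
        q-clear : Clear K (parkedBelow m) q
        q-clear = clear-outside q-out λ v∈ →
          (λ { refl → q∉I (outPart⊆ (K⊆I v∈)) }) , indJ _ _ q∈J (outPart⊆ (K⊆J v∈))

    sliding-inside : (sl : Slide G I J) → ¬ Outside (proj₁ sl) → ¬ Outside (proj₁ (proj₂ sl)) →
                     ∀ m → simulation I m ≡ simulation J m
    sliding-inside sl p-in q-in m = cong (λ F → conf F (parkedBelow m) nothing) (⊆-antisym
      (λ v∈ → slide-outPart sl v∈ λ { refl → p-in (outPart-outside v∈) })
      (λ v∈ → slide-outPart (slide-sym G sl) v∈ λ { refl → q-in (outPart-outside v∈) }))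

    simulation-of-outside : (∀ {v} → v ∈ I → Outside v) → simulation I 0 ≡ I
    simulation-of-outside I-outside = trans conf-parked-zero (outPart-of-outside I-outside)

    module _ {k : ℕ} (k≤g : k ≤ g) where

      private
        Simulated : Subset (n G) → Set
        Simulated I′ = ReconfSeq G k (AtMostOneInNC c) I′ It

        continue : Moves G Good I J → ∣ I ∣ ≡ k → (∣ J ∣ ≡ k → Simulated J) → Simulated I
        continue moves size simulated = prepend-moves G moves size (simulated (trans (sym (moves-size G moves)) size))

        It-outside : v ∈ It → Outside v
        It-outside = L1⇒outside ∘ inj₂

      simulate : ReconfSeq G k (Trivial G) I It →
                 ∀ m → m ≤ g → ∣ simulation I m ∣ ≡ k → Simulated (simulation I m)
      simulate (done (indIt , ∣It∣) _) zero _ _ =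
        subst Simulated (sym (simulation-of-outside It-outside))
              (done (indIt , ∣It∣) λ _ _ a∈ _ a∈N _ → contradiction a∈N (proj₂ (It-outside a∈)))
      simulate (done (indIt , ∣It∣) _) (suc m) m≤g size = contradiction (begin
        k + suc m                    ≡⟨ cong (_+ suc m) ∣It∣ ⟨
        ∣ It ∣ + suc m               ≡⟨ cong (λ I → ∣ I ∣ + suc m) (outPart-of-outside It-outside) ⟨
        ∣ outPart It ∣ + suc m       ≤⟨ parked-size (settled-outPart indIt) (suc m) m≤g ⟩
        ∣ simulation It (suc m) ∣    ≡⟨ size ⟩
        k                            ∎) (m+1+n≰m k)
        where open ≤-Reasoning
      simulate {I} (step (indI , ∣I∣) _ sl@(p , _ , _ , p∈I , _) rest) m m≤g size
        with indJ ← head-independent G rest | outside? p | outside? (proj₁ (proj₂ sl))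
      ... | yes p-out | yes q-out =
        continue (sliding-outside indI indJ sl p-out q-out m) size (simulate rest m m≤g)
      ... | no p-in | no q-in =
        continue (reflexive (SafeSlide G Good) (sliding-inside sl p-in q-in m)) size (simulate rest m m≤g)
      ... | yes p-out | no q-in =
        continue (entering indI indJ sl p-out q-in m<g) size (simulate rest (suc m) m<g)
        where
        open ≤-Reasoning
        m<g : m < g
        m<g = begin
          suc m                ≤⟨ +-monoˡ-≤ m (≤-trans (s≤s z≤n) (x∈p⇒∣p-x∣<∣p∣ (∈-outPart⁺ p∈I p-out))) ⟩
          ∣ outPart I ∣ + m    ≤⟨ parked-size (settled-outPart indI) m m≤g ⟩
          ∣ simulation I m ∣   ≡⟨ size ⟩
          k                    ≤⟨ k≤g ⟩
          g                    ∎
      ... | no p-in | yes q-out = exit m m≤g size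
        where
        exit : ∀ m → m ≤ g → ∣ simulation I m ∣ ≡ k → Simulated (simulation I m)
        exit zero _ size = contradiction (begin-strict
          k                      ≡⟨ size ⟨
          ∣ simulation I 0 ∣     ≡⟨ cong ∣_∣ conf-parked-zero ⟩
          ∣ outPart I ∣          <⟨ p⊂q⇒∣p∣<∣q∣ (outPart⊆ , p , p∈I , p-in ∘ outPart-outside) ⟩
          ∣ I ∣                  ≡⟨ ∣I∣ ⟩
          k                      ∎) (<-irrefl refl)
          where open ≤-Reasoning
        exit (suc m) m<g size =
          continue (moves-reverse G (entering indJ indI (slide-sym G sl) q-out p-in m<g)) size
                   (simulate rest m (<⇒≤ m<g))

  leg-of-degree-two : ∀ {u x} → Inside u → Inside x → E u x → DegTwoInComp c x → ∃ λ y → IsLeg u x y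
  leg-of-degree-two u-inside x-inside u~x (a , b , a≢b , a-inside , b-inside , x~a , x~b , only)
    with only _ u-inside (E-sym u~x)
  ... | inj₁ refl = b , record
    { u~x = u~x ; x~y = x~b ; x-inside = x-inside ; y-inside = b-inside ; y≢u = a≢b ∘ sym
    ; x-degree-two = λ w-inside x~w → only _ w-inside x~w }
  ... | inj₂ refl = a , record
    { u~x = u~x ; x~y = x~a ; x-inside = x-inside ; y-inside = a-inside ; y≢u = a≢b
    ; x-degree-two = λ w-inside x~w → swap (only _ w-inside x~w) }

  legs-of-degree-safe : ∀ {k} → DegreeSafe k c → ∃ λ u → Inside u × Σ (Legs u) λ legs → k ≤ Legs.g legs
  legs-of-degree-safe {k} (u , u-inside , Xs , Ds , _ , Xs-ok , _ , Ds-unique , Ds-ok , k²≤) =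
    u , u-inside , record
      { g = length S
      ; X = middle ∘ lookup S
      ; Y = end ∘ lookup S
      ; is-leg = λ i → proj₂ (leg (lookup S i))
      ; X-injective = lookup-injective S-unique ∘ lookup-injective Ds-unique
      ; Y-independent = λ i j → S-independent (∈-lookup i) (∈-lookup j) } ,
    k≤S
    where
    middle : Fin (length Ds) → V
    middle = lookup Ds
    leg : ∀ i → ∃ λ y → IsLeg u (middle i) y
    leg i with x∈Xs , degree-two ← lookupᴬ Ds-ok (∈-lookup i) with x-inside , u~x ← lookupᴬ Xs-ok x∈Xs =
      leg-of-degree-two u-inside x-inside u~x degree-two
    end : Fin (length Ds) → V
    end = proj₁ ∘ leg
    k*k≤ : k * k ≤ length (allFin (length Ds))
    k*k≤ = begin
      k * k                        ≡⟨ cong (k *_) (*-identityʳ k) ⟨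
      k ^ 2                        ≤⟨ k²≤ ⟩
      length Ds                    ≡⟨ length-tabulate id ⟨
      length (allFin (length Ds))  ∎
      where open ≤-Reasoning
    selection = independent-sublist (λ i j → adj? G (end i) (end j)) E-sym (Graph.irrefl G) no-triangle
                  k (allFin _) (allFin⁺ _) k*k≤
    S = proj₁ selection
    S-unique = proj₁ (proj₂ selection)
    S-independent = proj₁ (proj₂ (proj₂ (proj₂ selection)))
    k≤S = proj₂ (proj₂ (proj₂ (proj₂ selection)))

corollary1 : (G : Graph) (k : ℕ) (Is It : Subset (n G)) →
  GirthAtLeast5 G →
  IndSetOfSize G k Is → IndSetOfSize G k It →
  Layers.NoTwinsOutsideL1 G Is It →
  (c : Fin (n G)) → Layers.L3 G Is It c →
  Layers.DegreeSafe G Is It k c →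
  ReconfSeq G k (Trivial G) Is It →
  ReconfSeq G k (Layers.AtMostOneInNC G Is It c) Is It
corollary1 G k Is It girth (_ , ∣Is∣) _ _ c _ safe seq = from-legs (legs-of-degree-safe safe)
  where
  open Component G girth Is It c
  from-legs : (∃ λ u → Inside u × Σ (Legs u) λ legs → k ≤ Legs.g legs) → ReconfSeq G k (AtMostOneInNC c) Is It
  from-legs (u , u-inside , legs , k≤g) =
    subst (λ I → ReconfSeq G k (AtMostOneInNC c) I It) start (simulate k≤g seq 0 z≤n size₀)
    where
    open Maneuvers u-inside legs
    start : simulation Is 0 ≡ Is
    start = simulation-of-outside (L1⇒outside ∘ inj₁)
    size₀ : ∣ simulation Is 0 ∣ ≡ k
    size₀ = trans (cong ∣_∣ start) ∣Is∣
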